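{- Let $n$ be a nonnegative integer. (1) For each integer partition $\lambda$ of $n$, the number of set partitions of $[n]$ of shape $\lambda$ equals $\sum_{T\in\mathrm{Tab}_{[n]}(\lambda)} c(T)$. (2) For each nonnegative integer $m$, the Stirling number of the second kind satisfies $S(n,m)=\sum_{\lambda\vdash n,\ l(\lambda)=m}\sum_{T\in\mathrm{Tab}_{[n]}(\lambda)}c(T)$. (3) For every positive integer $n$, the Bell number $B_n$ (the number of set partitions of $[n]$) equals $\sum_{T\in\mathrm{Tab}_{[n]}}c(T)$.
   Context: The shape of a set partition is the list of its block sizes in weakly decreasing order. $\mathrm{Tab}_{[n]}(\lambda)$ is the set of standard tableaux of shape $\lambda$ (fillings of the Young diagram of $\lambda$ by $1,\dots,n$ with rows increasing left to right and columns increasing top to bottom), and $\mathrm{Tab}_{[n]}$ is the set of all standard tableaux with $n$ cells. $l(\lambda)$ is the number of parts of $\lambda$. For a standard tableau $T$ of shape $(\lambda_1,\dots,\lambda_m)$ and $2\le j\le\lambda_i$, $c_{ij}(T)=\#\{i'\ge i:\text{cell }(i',j-1)\text{ exists and }T_{i',j-1}<T_{ij}\}$, and $c(T)=\prod_i\prod_{j=2}^{\lambda_i}c_{ij}(T)$. -}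

module Defs where

open import Data.Nat using (ℕ; zero; suc; _+_; _*_; _<_; _≥_; _<ᵇ_)
open import Data.Fin using (Fin)
open import Data.List using (List; []; _∷_; map; concat; length; upTo)
open import Data.Nat.ListAction using (sum)
open import Data.List.Relation.Unary.All using (All)
open import Data.List.Relation.Unary.Linked using (Linked)
open import Data.List.Relation.Binary.Permutation.Propositional using (_↭_)
open import Data.Maybe using (Maybe; just; nothing)
open import Data.Bool using (if_then_else_)
open import Data.Product using (Σ; _×_; ∃)
open import Data.Unit using (⊤)
open import Data.Empty using (⊥)
open import Relation.Binary.PropositionalEquality using (_≡_)

-- Counting: `P HasCount k` means the set {d : D | P d} has exactly k
-- elements (elements compared by ≡ on the underlying data d, so proof
-- terms of P do not matter).

_HasCount_ : {D : Set} → (D → Set) → ℕ → Set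
_HasCount_ {D} P k =
  Σ (Fin k → D) λ f →
    (∀ i → P (f i)) ×
    (∀ i j → f i ≡ f j → i ≡ j) ×
    (∀ d → P d → ∃ λ i → f i ≡ d)

[_] : ℕ → List ℕ
[ n ] = map suc (upTo n)

IsPartition : ℕ → List ℕ → Set
IsPartition n lam = Linked _≥_ lam × All (λ p → 0 < p) lam × sum lam ≡ n

-- Set partitions of [n], in canonical form: a list of blocks, each block
-- a nonempty strictly increasing list of elements, blocks listed by
-- increasing minimum, and the blocks together containing every element
-- of [n] exactly once.

HeadLt : List ℕ → List ℕ → Set
HeadLt (x ∷ _) (y ∷ _) = x < y
HeadLt _ _ = ⊥

IsSetPartition : ℕ → List (List ℕ) → Set
IsSetPartition n blocks =
  All (λ b → 0 < length b) blocks ×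
  All (Linked _<_) blocks ×
  Linked HeadLt blocks ×
  concat blocks ↭ [ n ]

-- the shape of a set partition is the multiset of block sizes, written
-- weakly decreasingly; since λ is weakly decreasing, "shape = λ" is
-- "the list of block sizes is a rearrangement of λ".
HasShape : List (List ℕ) → List ℕ → Set
HasShape blocks lam = map length blocks ↭ lam

-- Standard tableaux with n cells, given as the list of rows (top to bottom).

ColsInc : List ℕ → List ℕ → Set
ColsInc (a ∷ as) (b ∷ bs) = a < b × ColsInc as bs
ColsInc [] (_ ∷ _) = ⊥
ColsInc _ [] = ⊤

IsStdTab : ℕ → List (List ℕ) → Set
IsStdTab n T =
  IsPartition n (map length T) ×
  All (Linked _<_) T ×
  Linked ColsInc T ×
  concat T ↭ [ n ]

IsStdTabOfShape : ℕ → List ℕ → List (List ℕ) → Set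
IsStdTabOfShape n lam T = map length T ≡ lam × IsStdTab n T

at : List ℕ → ℕ → Maybe ℕ
at [] _ = nothing
at (x ∷ xs) zero = just x
at (x ∷ xs) (suc j) = at xs j

-- number of rows among `rs` whose entry in column `col` (0-indexed)
-- exists and is < v
cnt : List (List ℕ) → ℕ → ℕ → ℕ
cnt [] col v = 0
cnt (r ∷ rs) col v = lt (at r col) + cnt rs col v
  where
  lt : Maybe ℕ → ℕ
  lt nothing = 0
  lt (just x) = if x <ᵇ v then 1 else 0

-- product over the entries of a row (current 0-indexed column `j`) of
-- c_{ij}, where `rs` are the rows i, i+1, … (the row itself first)
rowFactor : List (List ℕ) → ℕ → List ℕ → ℕ
rowFactor rs j [] = 1
rowFactor rs zero (x ∷ xs) = rowFactor rs 1 xs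
rowFactor rs (suc j) (x ∷ xs) = cnt rs j x * rowFactor rs (suc (suc j)) xs

-- c(T) = ∏_i ∏_{j=2}^{λ_i} c_{ij}(T)
c : List (List ℕ) → ℕ
c [] = 1
c (r ∷ rs) = rowFactor (r ∷ rs) 0 r * c rs

-- Removing the largest element n from a set partition of [n] leaves a set partition of [n-1];
-- conversely n may join any of the m_s blocks of size s ≥ 1, or form a new singleton block (s = 0).
-- In a standard tableau, n must instead end the topmost row of some length s (or start a new row),
-- and the new cell contributes exactly the factor m_s to c(T), as its column has smaller entries
-- precisely in the rows of length s. So, by induction on n, set partitions of [n] correspond to pairs
-- (T , i) with i < c(T): T records the sizes s of the blocks joined by n, n-1, …, 1, and i records in
-- mixed radix which of the m_s blocks was joined each time. The correspondence preserves the multiset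
-- of block sizes, which gives all three counts.
module Submission where

open import Defs
open import Data.Nat using (ℕ; _<_; _≤_)
open import Data.List using (List; length)
open import Data.Product using (Σ; _×_; ∃; _,_)
open import Relation.Binary.PropositionalEquality using (_≡_)

open import Data.Bool using (true; false; if_then_else_) renaming (T to IsTrue)
open import Data.Empty using (⊥-elim)
import Data.Fin as Fin
open import Data.List
  using ([]; _∷_; _∷ʳ_; _++_; head; map; concat; concatMap; filter; upTo; lookup; deduplicate)
import Data.List.Properties as LP
open import Data.List.Membership.Propositional using (_∈_; find; lose)
open import Data.List.Membership.Propositional.Properties
  using ( ∈-++⁻; ∈-++⁺ʳ; ∈-map⁺; ∈-map⁻; ∈-upTo⁺; ∈-upTo⁻; ∈-lookup
        ; ∈-filter⁺; ∈-filter⁻; ∈-concatMap⁺; ∈-concatMap⁻; ∈-deduplicate⁺; ∈-deduplicate⁻)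
open import Data.List.Relation.Binary.Equality.Propositional using (≋⇒≡)
open import Data.List.Relation.Binary.Permutation.Propositional
  using (_↭_; ↭-sym; ↭-trans; ↭-refl; ↭-prep; ↭-reflexive; ↭⇒↭ₛ)
import Data.List.Relation.Binary.Permutation.Propositional.Properties as PP
open import Data.List.Relation.Unary.All using (All; []; _∷_)
import Data.List.Relation.Unary.All as All
import Data.List.Relation.Unary.All.Properties as AllP
open import Data.List.Relation.Unary.AllPairs using (_∷_)
open import Data.List.Relation.Unary.Any using (here; there)
import Data.List.Relation.Unary.Any as Any
open import Data.List.Relation.Unary.Any.Properties using (lookup-index)
open import Data.List.Relation.Unary.Linked using (Linked; []; [-]; _∷_; head′; _∷′_)
import Data.List.Relation.Unary.Linked as Linked
import Data.List.Relation.Unary.Linked.Properties as LinkedP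
open import Data.List.Relation.Unary.Sorted.TotalOrder.Properties using (↗↭↗⇒≋)
open import Data.List.Relation.Unary.Unique.Propositional using (Unique)
import Data.List.Relation.Unary.Unique.Propositional.Properties as UniqueP
open import Data.List.Relation.Unary.Unique.DecPropositional.Properties using (deduplicate-!)
open import Data.Maybe using (Maybe; just; nothing)
import Data.Maybe as Maybe
open import Data.Maybe.Relation.Binary.Connected using (Connected; just; just-nothing)
open import Data.Nat
  using (zero; suc; _+_; _*_; _/_; _%_; _≟_; z≤n; s≤s; _≥_; _<ᵇ_; >-nonZero; >-nonZero⁻¹)
import Data.Nat.DivMod as DM
open import Data.Nat.ListAction using (sum)
import Data.Nat.Properties as NP
open import Algebra.Properties.CommutativeSemigroup NP.*-commutativeSemigroup using (xy∙z≈xz∙y)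
open import Data.Product using (proj₁; proj₂; ∃₂; uncurry)
open import Data.Sum using (_⊎_; inj₁; inj₂)
open import Data.Unit using (⊤; tt)
open import Function using (_∘_; id; _⇔_; Equivalence; mk⇔)
open import Level using (0ℓ)
open import Relation.Binary using (Rel; DecidableEquality)
import Relation.Binary.Properties.TotalOrder as TotalOrderProperties
open import Relation.Binary.PropositionalEquality
  using (refl; sym; trans; cong; cong₂; subst; _≢_; module ≡-Reasoning)
open import Relation.Nullary using (yes; no)
open import Relation.Unary using (Decidable)

length-∷ʳ : ∀ {A : Set} (xs : List A) x → length (xs ∷ʳ x) ≡ suc (length xs)
length-∷ʳ xs x = trans (LP.length-++ xs) (NP.+-comm (length xs) 1)

length-concat : ∀ {A : Set} (xss : List (List A)) → length (concat xss) ≡ sum (map length xss)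
length-concat []         = refl
length-concat (xs ∷ xss) = trans (LP.length-++ xs) (cong (length xs +_) (length-concat xss))

Linked-∷ʳ⁻ : ∀ {A : Set} {R : Rel A 0ℓ} xs x → Linked R (xs ∷ʳ x) → Linked R xs
Linked-∷ʳ⁻ []           x _          = []
Linked-∷ʳ⁻ (y ∷ [])     x _          = [-]
Linked-∷ʳ⁻ (y ∷ z ∷ xs) x (Ryz ∷ l) = Ryz ∷ Linked-∷ʳ⁻ (z ∷ xs) x l

Linked-∷ʳ⁺ : ∀ {A : Set} {R : Rel A 0ℓ} xs x →
             Linked R xs → All (λ y → R y x) xs → Linked R (xs ∷ʳ x)
Linked-∷ʳ⁺ []           x _         _          = [-]
Linked-∷ʳ⁺ (y ∷ [])     x _         (Ryx ∷ _)  = Ryx ∷ [-]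
Linked-∷ʳ⁺ (y ∷ z ∷ xs) x (Ryz ∷ l) (_ ∷ Rxs) = Ryz ∷ Linked-∷ʳ⁺ (z ∷ xs) x l Rxs

Linked-≥⇒All-≤ : ∀ {x xs} → Linked _≥_ (x ∷ xs) → All (_≤ x) xs
Linked-≥⇒All-≤ [-]          = []
Linked-≥⇒All-≤ (x≥y ∷ ≥ys) = LinkedP.Linked⇒All (λ p q → NP.≤-trans q p) x≥y ≥ys

sorted-↭⇒≡ : ∀ {xs ys} → Linked _≥_ xs → Linked _≥_ ys → xs ↭ ys → xs ≡ ys
sorted-↭⇒≡ xs≥ ys≥ p =
  ≋⇒≡ (↗↭↗⇒≋ (TotalOrderProperties.≥-totalOrder NP.≤-totalOrder) xs≥ ys≥ (↭⇒↭ₛ p))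

multiplicity : ℕ → List ℕ → ℕ
multiplicity s = length ∘ filter (_≟ s)

-- The number of blocks of size s that a new element can join; s = 0 stands for a new singleton block.
slots : List ℕ → ℕ → ℕ
slots a zero    = 1
slots a (suc s) = multiplicity (suc s) a

slots-∷-≢ : ∀ {x} s a → x ≢ s → slots (x ∷ a) s ≡ slots a s
slots-∷-≢ zero    a x≢s = refl
slots-∷-≢ (suc s) a x≢s = cong length (LP.filter-reject (_≟ suc s) x≢s)

slots-∷-≡ : ∀ {x} k a → x ≡ suc k → slots (x ∷ a) (suc k) ≡ suc (slots a (suc k))
slots-∷-≡ k a x≡ = cong length (LP.filter-accept (_≟ suc k) x≡)

slots-↭ : ∀ s {a b} → a ↭ b → slots a s ≡ slots b s
slots-↭ zero    p = refl
slots-↭ (suc s) p = PP.↭-length (PP.filter-↭ (_≟ suc s) p)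

-- Adding and removing the largest element

shape : List (List ℕ) → List ℕ
shape = map length

NonEmptyBlocks : List (List ℕ) → Set
NonEmptyBlocks = All (λ b → 0 < length b)

IncreasingBlocks : List (List ℕ) → Set
IncreasingBlocks = All (Linked _<_)

AllBelow : ℕ → List (List ℕ) → Set
AllBelow v = All (All (_< v))

AllAtMost : ℕ → List (List ℕ) → Set
AllAtMost v = All (All (_≤ v))

stripLast : ℕ → List ℕ → Maybe (List ℕ)
stripLast v []           = nothing
stripLast v (x ∷ [])     with x ≟ v
... | yes _ = just []
... | no  _ = nothing
stripLast v (x ∷ y ∷ xs) = Maybe.map (x ∷_) (stripLast v (y ∷ xs))

stripLast-∷ʳ : ∀ v b → stripLast v (b ∷ʳ v) ≡ just b
stripLast-∷ʳ v []           with v ≟ v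
... | yes _  = refl
... | no v≢v = ⊥-elim (v≢v refl)
stripLast-∷ʳ v (x ∷ [])     rewrite stripLast-∷ʳ v []      = refl
stripLast-∷ʳ v (x ∷ y ∷ b) rewrite stripLast-∷ʳ v (y ∷ b) = refl

stripLast-just : ∀ v b {b′} → stripLast v b ≡ just b′ → b ≡ b′ ∷ʳ v
stripLast-just v (x ∷ [])     eq with x ≟ v
stripLast-just v (x ∷ [])     refl | yes refl = refl
stripLast-just v (x ∷ y ∷ xs) eq with stripLast v (y ∷ xs) in e
stripLast-just v (x ∷ y ∷ xs) refl | just _ = cong (x ∷_) (stripLast-just v (y ∷ xs) e)

stripLast-< : ∀ v b → All (_< v) b → stripLast v b ≡ nothing
stripLast-< v []           _           = refl
stripLast-< v (x ∷ [])     (x<v ∷ []) with x ≟ v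
... | yes refl = ⊥-elim (NP.<-irrefl refl x<v)
... | no  _    = refl
stripLast-< v (x ∷ y ∷ xs) (_ ∷ ys<v) rewrite stripLast-< v (y ∷ xs) ys<v = refl

stripLast-max : ∀ v b → Linked _<_ b → All (_≤ v) b → v ∈ b → stripLast v b ≢ nothing
stripLast-max v (x ∷ [])     _         _              (here refl) e with v ≟ v
... | no v≢v = v≢v refl
stripLast-max v (x ∷ y ∷ xs) (x<y ∷ _) (_ ∷ y≤v ∷ _) (here refl) _ =
  NP.<-irrefl refl (NP.<-≤-trans x<y y≤v)
stripLast-max v (x ∷ y ∷ xs) (_ ∷ inc) (_ ∷ ≤v)       (there v∈) e
  with stripLast v (y ∷ xs) in e′
... | nothing = stripLast-max v (y ∷ xs) inc ≤v v∈ e′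

-- v is appended to the (r+1)-st block of size s, or becomes a new last block when s = 0.
insert : ℕ → ℕ → ℕ → List (List ℕ) → List (List ℕ)
insertHere : ℕ → ℕ → ℕ → List ℕ → List (List ℕ) → List (List ℕ)
insert v s r []      = (v ∷ []) ∷ []
insert v s r (b ∷ P) with length b ≟ s
... | yes _ = insertHere v s r b P
... | no  _ = b ∷ insert v s r P
insertHere v s zero    b P = (b ∷ʳ v) ∷ P
insertHere v s (suc r) b P = b ∷ insert v s r P

insert-∷-≡ : ∀ v s r b P → length b ≡ s → insert v s r (b ∷ P) ≡ insertHere v s r b P
insert-∷-≡ v s r b P ≡s with length b ≟ s
... | yes _  = refl
... | no ≢s = ⊥-elim (≢s ≡s)

Removal : Set
Removal = List (List ℕ) × ℕ × ℕ

countIf≡ : ℕ → ℕ → ℕ → ℕ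
countIf≡ l s r with l ≟ s
... | yes _ = suc r
... | no  _ = r

countIf≡-≡ : ∀ s r → countIf≡ s s r ≡ suc r
countIf≡-≡ s r with s ≟ s
... | yes _  = refl
... | no s≢s = ⊥-elim (s≢s refl)

countIf≡-≢ : ∀ l s r → l ≢ s → countIf≡ l s r ≡ r
countIf≡-≢ l s r l≢s with l ≟ s
... | yes l≡s = ⊥-elim (l≢s l≡s)
... | no  _   = refl

-- Returns (P′ , s , r) with P = insert v s r P′: the block of v, minus v, has size s,
-- and r earlier blocks have size s.
remove : ℕ → List (List ℕ) → Removal
removeFrom : ℕ → List ℕ → List (List ℕ) → Maybe (List ℕ) → Removal → Removal
remove v []      = [] , 0 , 0
remove v (b ∷ P) = removeFrom v b P (stripLast v b) (remove v P)
removeFrom v b P (just [])       _             = P , 0 , 0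
removeFrom v b P (just (y ∷ ys)) _             = (y ∷ ys) ∷ P , suc (length ys) , 0
removeFrom v b P nothing         (P′ , s , r) = b ∷ P′ , s , countIf≡ (length b) s r

remove-insert : ∀ v s r P → NonEmptyBlocks P → AllBelow v P → r < slots (shape P) s →
                remove v (insert v s r P) ≡ (P , s , r)
remove-insert v zero zero    [] _ _ _ rewrite stripLast-∷ʳ v [] = refl
remove-insert v zero (suc r) [] _ _ (s≤s ())
remove-insert v s r ((y ∷ ys) ∷ P) (_ ∷ ne) (b<v ∷ P<v) r< with suc (length ys) ≟ s
... | no ≢s
  rewrite stripLast-< v (y ∷ ys) b<v
        | remove-insert v s r P ne P<v (subst (r <_) (slots-∷-≢ s (shape P) ≢s) r<)
        | countIf≡-≢ (suc (length ys)) s r ≢s = refl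
remove-insert v .(suc (length ys)) zero ((y ∷ ys) ∷ P) _ _ _ | yes refl
  rewrite stripLast-∷ʳ v (y ∷ ys) = refl
remove-insert v .(suc (length ys)) (suc r) ((y ∷ ys) ∷ P) (_ ∷ ne) (b<v ∷ P<v) r< | yes refl
  rewrite stripLast-< v (y ∷ ys) b<v
        | remove-insert v (suc (length ys)) r P ne P<v
            (NP.≤-pred (subst (suc r <_) (slots-∷-≡ (length ys) (shape P) refl) r<))
        | countIf≡-≡ (suc (length ys)) r = refl

IsRemoval : ℕ → List (List ℕ) → Removal → Set
IsRemoval v P (P′ , s , r) =
  insert v s r P′ ≡ P × NonEmptyBlocks P′ × IncreasingBlocks P′ × r < slots (shape P′) s

-- insert only creates a singleton block {v} at the end.
SingletonLast : ℕ → List (List ℕ) → Set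
SingletonLast v []      = ⊤
SingletonLast v (b ∷ P) = (b ≡ v ∷ [] → P ≡ []) × SingletonLast v P

slots-insertHere : ∀ (b : List ℕ) s r a → length b ≡ s → 0 < length b → r < slots a s →
                   suc r < slots (length b ∷ a) s
slots-insertHere (_ ∷ b) .(suc (length b)) r a refl _ r< rewrite slots-∷-≡ (length b) a refl = s≤s r<

insert-remove : ∀ v P → NonEmptyBlocks P → IncreasingBlocks P → AllAtMost v P → v ∈ concat P →
                SingletonLast v P → IsRemoval v P (remove v P)
insert-remove v (b ∷ P) (ne ∷ nes) (inc ∷ incs) (≤v ∷ ≤vs) v∈ (last , lasts)
  with stripLast v b in e
... | just [] with refl ← stripLast-just v b e with refl ← last refl =
  refl , [] , [] , s≤s z≤n
... | just (y ∷ ys) with refl ← stripLast-just v b e =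
  insert-∷-≡ v _ 0 (y ∷ ys) P refl , s≤s z≤n ∷ nes , Linked-∷ʳ⁻ (y ∷ ys) v inc ∷ incs ,
  subst (0 <_) (sym (slots-∷-≡ (length ys) (shape P) refl)) (s≤s z≤n)
... | nothing with ∈-++⁻ b v∈
...   | inj₁ v∈b = ⊥-elim (stripLast-max v b inc ≤v v∈b e)
...   | inj₂ v∈P with remove v P | insert-remove v P nes incs ≤vs v∈P lasts
...     | (P′ , s , r) | (ins≡ , ne′ , inc′ , r<) with length b ≟ s
...       | yes ≡s = cong (b ∷_) ins≡ , ne ∷ ne′ , inc ∷ inc′ ,
                     slots-insertHere b s r (shape P′) ≡s ne r<
...       | no ≢s  = cong (b ∷_) ins≡ , ne ∷ ne′ , inc ∷ inc′ ,
                     subst (r <_) (sym (slots-∷-≢ s (shape P′) ≢s)) r<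

concat-insert : ∀ v s r P → concat (insert v s r P) ↭ v ∷ concat P
concat-insert v s r []      = ↭-refl
concat-insert v s r (b ∷ P) with length b ≟ s
concat-insert v s zero    (b ∷ P) | yes _
  rewrite LP.++-assoc b (v ∷ []) (concat P) = PP.shift v b (concat P)
concat-insert v s (suc r) (b ∷ P) | yes _ =
  ↭-trans (PP.++⁺ˡ b (concat-insert v s r P)) (PP.shift v b (concat P))
concat-insert v s r       (b ∷ P) | no _  =
  ↭-trans (PP.++⁺ˡ b (concat-insert v s r P)) (PP.shift v b (concat P))

ShapeGrows : ℕ → List ℕ → List ℕ → Set
ShapeGrows s a a′ =
  (s ≡ 0 × a′ ≡ a ∷ʳ 1) ⊎
  (∃₂ λ a₁ a₂ → a ≡ a₁ ++ s ∷ a₂ × a′ ≡ a₁ ++ suc s ∷ a₂)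

ShapeGrows-∷ : ∀ x s a a′ → ShapeGrows s a a′ → ShapeGrows s (x ∷ a) (x ∷ a′)
ShapeGrows-∷ x s a a′ (inj₁ (s≡0 , a′≡))            = inj₁ (s≡0 , cong (x ∷_) a′≡)
ShapeGrows-∷ x s a a′ (inj₂ (a₁ , a₂ , a≡ , a′≡)) =
  inj₂ (x ∷ a₁ , a₂ , cong (x ∷_) a≡ , cong (x ∷_) a′≡)

shape-insert : ∀ v s r P → NonEmptyBlocks P → r < slots (shape P) s →
               ShapeGrows s (shape P) (shape (insert v s r P))
shape-insert v zero zero    [] _ _ = inj₁ (refl , refl)
shape-insert v zero (suc r) [] _ (s≤s ())
shape-insert v s r ((y ∷ ys) ∷ P) (_ ∷ ne) r< with suc (length ys) ≟ s
... | no ≢s =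
  ShapeGrows-∷ _ s _ _ (shape-insert v s r P ne (subst (r <_) (slots-∷-≢ s (shape P) ≢s) r<))
shape-insert v .(suc (length ys)) zero ((y ∷ ys) ∷ P) _ _ | yes refl =
  inj₂ ([] , shape P , refl , cong (_∷ shape P) (length-∷ʳ (y ∷ ys) v))
shape-insert v .(suc (length ys)) (suc r) ((y ∷ ys) ∷ P) (_ ∷ ne) r< | yes refl =
  ShapeGrows-∷ _ _ _ _ (shape-insert v _ r P ne
    (NP.≤-pred (subst (suc r <_) (slots-∷-≡ (length ys) (shape P) refl) r<)))

ShapeGrows-↭ : ∀ s a b a′ b′ → All (0 <_) a → a ↭ b →
               ShapeGrows s a a′ → ShapeGrows s b b′ → a′ ↭ b′
ShapeGrows-↭ s a b a′ b′ pos p (inj₁ (_ , refl)) (inj₁ (_ , refl)) = PP.++⁺ʳ (1 ∷ []) p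
ShapeGrows-↭ s a b a′ b′ pos p (inj₁ (refl , _)) (inj₂ (b₁ , _ , refl , _))
  with () ∷ _ ← AllP.++⁻ʳ b₁ (PP.All-resp-↭ p pos)
ShapeGrows-↭ s a b a′ b′ pos p (inj₂ (a₁ , _ , refl , _)) (inj₁ (refl , _))
  with () ∷ _ ← AllP.++⁻ʳ a₁ pos
ShapeGrows-↭ s a b a′ b′ pos p (inj₂ (a₁ , a₂ , refl , refl)) (inj₂ (b₁ , b₂ , refl , refl)) =
  ↭-trans (PP.shift (suc s) a₁ a₂)
          (↭-trans (↭-prep (suc s) (PP.drop-mid a₁ b₁ p)) (↭-sym (PP.shift (suc s) b₁ b₂)))

All-insert : ∀ {Q : List ℕ → Set} v s r P →
             All (λ b → Q b × Q (b ∷ʳ v)) P → Q (v ∷ []) → All Q (insert v s r P)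
All-insert v s r []      _                 q = q ∷ []
All-insert v s r (b ∷ P) ((q₁ , q₂) ∷ qs) q with length b ≟ s
All-insert v s zero    (b ∷ P) ((q₁ , q₂) ∷ qs) q | yes _ = q₂ ∷ All.map proj₁ qs
All-insert v s (suc r) (b ∷ P) ((q₁ , q₂) ∷ qs) q | yes _ = q₁ ∷ All-insert v s r P qs q
All-insert v s r       (b ∷ P) ((q₁ , q₂) ∷ qs) q | no  _ = q₁ ∷ All-insert v s r P qs q

NonEmptyBlocks-insert : ∀ v s r P → NonEmptyBlocks P → NonEmptyBlocks (insert v s r P)
NonEmptyBlocks-insert v s r P ne =
  All-insert v s r P (All.map (λ {b} 0< → 0< , subst (0 <_) (sym (length-∷ʳ b v)) (s≤s z≤n)) ne) (s≤s z≤n)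

IncreasingBlocks-insert : ∀ v s r P → IncreasingBlocks P → AllBelow v P →
                          IncreasingBlocks (insert v s r P)
IncreasingBlocks-insert v s r P inc <v =
  All-insert v s r P (All.zipWith (λ {b} (i , b<v) → i , Linked-∷ʳ⁺ b v i b<v) (inc , <v)) [-]

insert-head : ∀ v s r h P → ∃₂ λ h′ rest →
              insert v s r (h ∷ P) ≡ h′ ∷ rest × (h′ ≡ h ⊎ (h′ ≡ h ∷ʳ v × length h ≡ s))
insert-head v s r h P with length h ≟ s
insert-head v s zero    h P | yes ≡s = _ , _ , refl , inj₂ (refl , ≡s)
insert-head v s (suc r) h P | yes _  = _ , _ , refl , inj₁ refl
insert-head v s r       h P | no _   = _ , _ , refl , inj₁ refl

-- Set partitions

HeadLt-∷ʳˡ : ∀ y ys v c → HeadLt (y ∷ ys) c → HeadLt ((y ∷ ys) ∷ʳ v) c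
HeadLt-∷ʳˡ y ys v (_ ∷ _) p = p

HeadLt-∷ʳˡ⁻ : ∀ y ys v c → HeadLt ((y ∷ ys) ∷ʳ v) c → HeadLt (y ∷ ys) c
HeadLt-∷ʳˡ⁻ y ys v (_ ∷ _) p = p

HeadLt-∷ʳʳ : ∀ a y ys v → HeadLt a (y ∷ ys) → HeadLt a ((y ∷ ys) ∷ʳ v)
HeadLt-∷ʳʳ (_ ∷ _) y ys v p = p

HeadLt-∷ʳʳ⁻ : ∀ a y ys v → HeadLt a ((y ∷ ys) ∷ʳ v) → HeadLt a (y ∷ ys)
HeadLt-∷ʳʳ⁻ (_ ∷ _) y ys v p = p

Connected-HeadLt-insert⁺ : ∀ v s r a P → 0 < length a → All (_< v) a → NonEmptyBlocks P →
                           Connected HeadLt (just a) (head P) →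
                           Connected HeadLt (just a) (head (insert v s r P))
Connected-HeadLt-insert⁺ v s r (x ∷ a) [] _ (x<v ∷ _) _ _ = just x<v
Connected-HeadLt-insert⁺ v s r a (h ∷ P) _ _ (_ ∷ _) a<h with insert-head v s r h P
... | _ , _ , eq , inj₁ refl rewrite eq = a<h
Connected-HeadLt-insert⁺ v s r a ((y ∷ ys) ∷ P) _ _ (_ ∷ _) (just a<h) | _ , _ , eq , inj₂ (refl , _)
  rewrite eq = just (HeadLt-∷ʳʳ a y ys v a<h)

Connected-HeadLt-insert⁻ : ∀ v s r a P → NonEmptyBlocks P →
                           Connected HeadLt (just a) (head (insert v s r P)) →
                           Connected HeadLt (just a) (head P)
Connected-HeadLt-insert⁻ v s r a [] _ _ = just-nothing
Connected-HeadLt-insert⁻ v s r a (h ∷ P) (_ ∷ _) a<h with insert-head v s r h P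
... | _ , _ , eq , inj₁ refl rewrite eq = a<h
Connected-HeadLt-insert⁻ v s r a ((y ∷ ys) ∷ P) (_ ∷ _) a<h | _ , _ , eq , inj₂ (refl , _)
  rewrite eq with just a<h′ ← a<h = just (HeadLt-∷ʳʳ⁻ a y ys v a<h′)

Linked-HeadLt-insert⁺ : ∀ v s r P → Linked HeadLt P → NonEmptyBlocks P → AllBelow v P →
                        Linked HeadLt (insert v s r P)
Linked-HeadLt-insert⁺ v s r [] _ _ _ = [-]
Linked-HeadLt-insert⁺ v s r ((y ∷ ys) ∷ P) l (_ ∷ ne) (b<v ∷ P<v) with length (y ∷ ys) ≟ s
Linked-HeadLt-insert⁺ v s zero ((y ∷ ys) ∷ []) l _ _ | yes _ = [-]
Linked-HeadLt-insert⁺ v s zero ((y ∷ ys) ∷ c ∷ P) l _ _ | yes _ =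
  HeadLt-∷ʳˡ y ys v c (Linked.head l) ∷ Linked.tail l
Linked-HeadLt-insert⁺ v s (suc r) ((y ∷ ys) ∷ P) l (_ ∷ ne) (b<v ∷ P<v) | yes _ =
  Connected-HeadLt-insert⁺ v s r (y ∷ ys) P (s≤s z≤n) b<v ne (head′ l) ∷′
  Linked-HeadLt-insert⁺ v s r P (Linked.tail l) ne P<v
Linked-HeadLt-insert⁺ v s r ((y ∷ ys) ∷ P) l (_ ∷ ne) (b<v ∷ P<v) | no _ =
  Connected-HeadLt-insert⁺ v s r (y ∷ ys) P (s≤s z≤n) b<v ne (head′ l) ∷′
  Linked-HeadLt-insert⁺ v s r P (Linked.tail l) ne P<v

Linked-HeadLt-insert⁻ : ∀ v s r P → NonEmptyBlocks P → Linked HeadLt (insert v s r P) → Linked HeadLt P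
Linked-HeadLt-insert⁻ v s r [] _ _ = []
Linked-HeadLt-insert⁻ v s r ((y ∷ ys) ∷ P) (_ ∷ ne) l with length (y ∷ ys) ≟ s
Linked-HeadLt-insert⁻ v s zero ((y ∷ ys) ∷ []) _ l | yes _ = [-]
Linked-HeadLt-insert⁻ v s zero ((y ∷ ys) ∷ c ∷ P) _ l | yes _ =
  HeadLt-∷ʳˡ⁻ y ys v c (Linked.head l) ∷ Linked.tail l
Linked-HeadLt-insert⁻ v s (suc r) ((y ∷ ys) ∷ P) (_ ∷ ne) l | yes _ =
  Connected-HeadLt-insert⁻ v s r (y ∷ ys) P ne (head′ l) ∷′ Linked-HeadLt-insert⁻ v s r P ne (Linked.tail l)
Linked-HeadLt-insert⁻ v s r ((y ∷ ys) ∷ P) (_ ∷ ne) l | no _ =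
  Connected-HeadLt-insert⁻ v s r (y ∷ ys) P ne (head′ l) ∷′ Linked-HeadLt-insert⁻ v s r P ne (Linked.tail l)

SingletonLast-HeadLt : ∀ v P → Linked HeadLt P → AllAtMost v P → SingletonLast v P
SingletonLast-HeadLt v []          _         _               = tt
SingletonLast-HeadLt v (b ∷ [])    _         _               = (λ _ → refl) , tt
SingletonLast-HeadLt v (b ∷ c ∷ P) (b<c ∷ l) (_ ∷ c≤v ∷ P≤v) =
  singleton-first b c b<c c≤v , SingletonLast-HeadLt v (c ∷ P) l (c≤v ∷ P≤v)
  where
  singleton-first : ∀ b c → HeadLt b c → All (_≤ v) c → b ≡ v ∷ [] → c ∷ P ≡ []
  singleton-first _ (z ∷ c) v<z (z≤v ∷ _) refl = ⊥-elim (NP.<-irrefl refl (NP.<-≤-trans v<z z≤v))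

-- Tableaux

SingletonLast-ColsInc : ∀ v T → Linked ColsInc T → AllAtMost v T → NonEmptyBlocks T → SingletonLast v T
SingletonLast-ColsInc v []          _         _               _               = tt
SingletonLast-ColsInc v (b ∷ [])    _         _               _               = (λ _ → refl) , tt
SingletonLast-ColsInc v (b ∷ c ∷ T) (b<c ∷ l) (_ ∷ c≤v ∷ T≤v) (_ ∷ c≢[] ∷ ne) =
  singleton-first b c b<c c≤v c≢[] , SingletonLast-ColsInc v (c ∷ T) l (c≤v ∷ T≤v) (c≢[] ∷ ne)
  where
  singleton-first : ∀ b c → ColsInc b c → All (_≤ v) c → 0 < length c → b ≡ v ∷ [] → c ∷ T ≡ []
  singleton-first _ (z ∷ c) (v<z , _) (z≤v ∷ _) _ refl =
    ⊥-elim (NP.<-irrefl refl (NP.<-≤-trans v<z z≤v))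

ColsInc-∷ʳˡ : ∀ a b v → ColsInc a b → ColsInc (a ∷ʳ v) b
ColsInc-∷ʳˡ []      []      v _         = tt
ColsInc-∷ʳˡ (x ∷ a) []      v _         = tt
ColsInc-∷ʳˡ (x ∷ a) (y ∷ b) v (x<y , c) = x<y , ColsInc-∷ʳˡ a b v c

ColsInc-∷ʳˡ⁻ : ∀ a b v → ColsInc (a ∷ʳ v) b → length b ≤ length a → ColsInc a b
ColsInc-∷ʳˡ⁻ []      []      v _         _       = tt
ColsInc-∷ʳˡ⁻ (x ∷ a) []      v _         _       = tt
ColsInc-∷ʳˡ⁻ (x ∷ a) (y ∷ b) v (x<y , c) (s≤s l) = x<y , ColsInc-∷ʳˡ⁻ a b v c l

ColsInc-∷ʳ-length : ∀ a b v → ColsInc (a ∷ʳ v) b → All (_≤ v) b → length b ≤ length a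
ColsInc-∷ʳ-length a       []       v _         _         = z≤n
ColsInc-∷ʳ-length []      (y ∷ []) v (v<y , _) (y≤v ∷ _) =
  ⊥-elim (NP.<-irrefl refl (NP.<-≤-trans v<y y≤v))
ColsInc-∷ʳ-length (x ∷ a) (y ∷ b)  v (_ , c)   (_ ∷ b≤v) = s≤s (ColsInc-∷ʳ-length a b v c b≤v)

ColsInc-∷ʳʳ : ∀ a b v → ColsInc a b → length b < length a → All (_< v) a → ColsInc a (b ∷ʳ v)
ColsInc-∷ʳʳ (x ∷ [])     []      v _         _       (x<v ∷ _) = x<v , tt
ColsInc-∷ʳʳ (x ∷ x′ ∷ a) []      v _         _       (x<v ∷ _) = x<v , tt
ColsInc-∷ʳʳ (x ∷ a)      (y ∷ b) v (x<y , c) (s≤s l) (_ ∷ a<v) = x<y , ColsInc-∷ʳʳ a b v c l a<v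

ColsInc-∷ʳʳ⁻ : ∀ a b v → ColsInc a (b ∷ʳ v) → ColsInc a b
ColsInc-∷ʳʳ⁻ (x ∷ a) []      v _         = tt
ColsInc-∷ʳʳ⁻ (x ∷ a) (y ∷ b) v (x<y , c) = x<y , ColsInc-∷ʳʳ⁻ a b v c

Tableau-insert-head⁺ : ∀ v s a T → length a ≢ s → 0 < length a → All (_< v) a → NonEmptyBlocks T →
                       Connected _≥_ (just (length a)) (head (shape T)) →
                       Connected ColsInc (just a) (head T) →
                       Connected _≥_ (just (length a)) (head (shape (insert v s 0 T))) ×
                       Connected ColsInc (just a) (head (insert v s 0 T))
Tableau-insert-head⁺ v s (x ∷ [])     [] _ _ (x<v ∷ _) _ _ _ = just (s≤s z≤n) , just (x<v , tt)
Tableau-insert-head⁺ v s (x ∷ x′ ∷ a) [] _ _ (x<v ∷ _) _ _ _ = just (s≤s z≤n) , just (x<v , tt)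
Tableau-insert-head⁺ v s a (h ∷ T) a≢s _ a<v (_ ∷ _) a≥h a↑h with insert-head v s 0 h T
... | _ , _ , eq , inj₁ refl rewrite eq = a≥h , a↑h
Tableau-insert-head⁺ v s a (h ∷ T) a≢s _ a<v (_ ∷ _) (just a≥h) (just a↑h)
  | _ , _ , eq , inj₂ (refl , h≡s) rewrite eq =
  just (subst (_≤ length a) (sym (length-∷ʳ h v)) h<a) , just (ColsInc-∷ʳʳ a h v a↑h h<a a<v)
  where
  h<a : length h < length a
  h<a = NP.≤∧≢⇒< a≥h (λ h≡a → a≢s (trans (sym h≡a) h≡s))

Tableau-insert-head⁻ : ∀ v s a T → NonEmptyBlocks T →
                       Connected _≥_ (just (length a)) (head (shape (insert v s 0 T))) →
                       Connected ColsInc (just a) (head (insert v s 0 T)) →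
                       Connected _≥_ (just (length a)) (head (shape T)) ×
                       Connected ColsInc (just a) (head T)
Tableau-insert-head⁻ v s a [] _ _ _ = just-nothing , just-nothing
Tableau-insert-head⁻ v s a (h ∷ T) _ a≥h a↑h with insert-head v s 0 h T
... | _ , _ , eq , inj₁ refl rewrite eq = a≥h , a↑h
... | _ , _ , eq , inj₂ (refl , _) rewrite eq with just a≥h′ ← a≥h | just a↑h′ ← a↑h =
  just (NP.≤-trans (NP.n≤1+n _) (subst (_≤ length a) (length-∷ʳ h v) a≥h′)) ,
  just (ColsInc-∷ʳʳ⁻ a h v a↑h′)

Tableau-insert⁺ : ∀ v s T → NonEmptyBlocks T → AllBelow v T → Linked _≥_ (shape T) → Linked ColsInc T →
                  Linked _≥_ (shape (insert v s 0 T)) × Linked ColsInc (insert v s 0 T)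
Tableau-insert⁺ v s [] _ _ _ _ = [-] , [-]
Tableau-insert⁺ v s (h ∷ T) (ne ∷ nes) (h<v ∷ T<v) λ≥ ↑ with length h ≟ s
... | yes _ = longer T (head′ λ≥) ∷′ Linked.tail λ≥ , below T (head′ ↑) ∷′ Linked.tail ↑
  where
  longer : ∀ T → Connected _≥_ (just (length h)) (head (shape T)) →
           Connected _≥_ (just (length (h ∷ʳ v))) (head (shape T))
  longer []      _         = just-nothing
  longer (c ∷ T) (just h≥) rewrite length-∷ʳ h v = just (NP.m≤n⇒m≤1+n h≥)
  below : ∀ T → Connected ColsInc (just h) (head T) → Connected ColsInc (just (h ∷ʳ v)) (head T)
  below []      _         = just-nothing
  below (c ∷ T) (just h↑) = just (ColsInc-∷ʳˡ h c v h↑)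
... | no h≢s with Tableau-insert⁺ v s T nes T<v (Linked.tail λ≥) (Linked.tail ↑)
                | Tableau-insert-head⁺ v s h T h≢s ne h<v nes (head′ λ≥) (head′ ↑)
... | (≥′ , ↑′) | (h≥ , h↑) = h≥ ∷′ ≥′ , h↑ ∷′ ↑′

Tableau-insert⁻ : ∀ v s T → NonEmptyBlocks T → AllBelow v T →
                  Linked _≥_ (shape (insert v s 0 T)) → Linked ColsInc (insert v s 0 T) →
                  Linked _≥_ (shape T) × Linked ColsInc T
Tableau-insert⁻ v s [] _ _ _ _ = [] , []
Tableau-insert⁻ v s (h ∷ T) (ne ∷ nes) (h<v ∷ T<v) λ≥ ↑ with length h ≟ s
... | yes _ = shorter T T<v (head′ ↑) ∷′ Linked.tail λ≥ , above T T<v (head′ ↑) ∷′ Linked.tail ↑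
  where
  shorter : ∀ T → AllBelow v T → Connected ColsInc (just (h ∷ʳ v)) (head T) →
            Connected _≥_ (just (length h)) (head (shape T))
  shorter []      _         _          = just-nothing
  shorter (c ∷ T) (c<v ∷ _) (just h↑c) = just (ColsInc-∷ʳ-length h c v h↑c (All.map NP.<⇒≤ c<v))
  above : ∀ T → AllBelow v T → Connected ColsInc (just (h ∷ʳ v)) (head T) →
          Connected ColsInc (just h) (head T)
  above []      _         _          = just-nothing
  above (c ∷ T) (c<v ∷ _) (just h↑c) =
    just (ColsInc-∷ʳˡ⁻ h c v h↑c (ColsInc-∷ʳ-length h c v h↑c (All.map NP.<⇒≤ c<v)))
... | no _ with Tableau-insert⁻ v s T nes T<v (Linked.tail λ≥) (Linked.tail ↑)
               | Tableau-insert-head⁻ v s h T nes (head′ λ≥) (head′ ↑)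
... | (≥′ , ↑′) | (h≥ , h↑) = h≥ ∷′ ≥′ , h↑ ∷′ ↑′

-- In a tableau v can only end the topmost row of its length: ending a later one would put a row of
-- length s + 1 below one of length s.
insert-sorted⇒r≡0 : ∀ v s r T → NonEmptyBlocks T → r < slots (shape T) s →
                    Linked _≥_ (shape (insert v s r T)) → r ≡ 0
insert-sorted⇒r≡0 v zero zero    [] _ _ _ = refl
insert-sorted⇒r≡0 v zero (suc r) [] _ (s≤s ()) _
insert-sorted⇒r≡0 v s r ((y ∷ ys) ∷ T) (_ ∷ ne) r< λ≥ with suc (length ys) ≟ s
... | no ≢s =
  insert-sorted⇒r≡0 v s r T ne (subst (r <_) (slots-∷-≢ s (shape T) ≢s) r<) (Linked.tail λ≥)
insert-sorted⇒r≡0 v .(suc (length ys)) zero ((y ∷ ys) ∷ T) _ _ _ | yes refl = refl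
insert-sorted⇒r≡0 v .(suc (length ys)) (suc r) ((y ∷ ys) ∷ T) (_ ∷ ne) r< λ≥ | yes refl
  with shape-insert v (suc (length ys)) r T ne
         (NP.≤-pred (subst (suc r <_) (slots-∷-≡ (length ys) (shape T) refl) r<))
... | inj₁ (() , _)
... | inj₂ (a₁ , _ , _ , a′≡)
  with 2+s≤1+s ∷ _ ← AllP.++⁻ʳ a₁ (subst (All (_≤ suc (length ys))) a′≡ (Linked-≥⇒All-≤ λ≥)) =
  ⊥-elim (NP.<-irrefl refl 2+s≤1+s)

-- The statistic c

-- The summand of cnt, which Defs leaves local to its definition.
countBelow : ℕ → Maybe ℕ → ℕ
countBelow v nothing  = 0
countBelow v (just y) = if y <ᵇ v then 1 else 0

cnt-∷ : ∀ r rs k v → cnt (r ∷ rs) k v ≡ countBelow v (at r k) + cnt rs k v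
cnt-∷ r rs k v with at r k
... | nothing = refl
... | just _  = refl

countBelow-≥ : ∀ v y → v ≤ y → countBelow v (just y) ≡ 0
countBelow-≥ v y v≤y with y <ᵇ v in e
... | false = refl
... | true  = ⊥-elim (NP.<⇒≱ (NP.<ᵇ⇒< y v (subst IsTrue (sym e) tt)) v≤y)

countBelow-< : ∀ v y → y < v → countBelow v (just y) ≡ 1
countBelow-< v y y<v with y <ᵇ v in e
... | true  = refl
... | false = ⊥-elim (subst IsTrue e (NP.<⇒<ᵇ y<v))

countBelow-∷ʳ : ∀ x v b k → x ≤ v → countBelow x (at (b ∷ʳ v) k) ≡ countBelow x (at b k)
countBelow-∷ʳ x v []      zero    x≤v = countBelow-≥ x v x≤v
countBelow-∷ʳ x v []      (suc k) x≤v = refl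
countBelow-∷ʳ x v (y ∷ b) zero    x≤v = refl
countBelow-∷ʳ x v (y ∷ b) (suc k) x≤v = countBelow-∷ʳ x v b k x≤v

cnt-insert : ∀ v s r T k x → x ≤ v → cnt (insert v s r T) k x ≡ cnt T k x
cnt-insert v s r []      k x x≤v = trans (cnt-∷ (v ∷ []) [] k x) (cong (_+ 0) (countBelow-∷ʳ x v [] k x≤v))
cnt-insert v s r (b ∷ T) k x x≤v with length b ≟ s
cnt-insert v s zero (b ∷ T) k x x≤v | yes _ = begin
  cnt ((b ∷ʳ v) ∷ T) k x                   ≡⟨ cnt-∷ (b ∷ʳ v) T k x ⟩
  countBelow x (at (b ∷ʳ v) k) + cnt T k x ≡⟨ cong (_+ cnt T k x) (countBelow-∷ʳ x v b k x≤v) ⟩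
  countBelow x (at b k) + cnt T k x        ≡⟨ cnt-∷ b T k x ⟨
  cnt (b ∷ T) k x                          ∎
  where open ≡-Reasoning
cnt-insert v s (suc r) (b ∷ T) k x x≤v | yes _ = cong₂ _+_ refl (cnt-insert v s r T k x x≤v)
cnt-insert v s r       (b ∷ T) k x x≤v | no _  = cong₂ _+_ refl (cnt-insert v s r T k x x≤v)

rowFactor-cong : ∀ v rs rs′ j row → All (_≤ v) row →
                 (∀ k x → x ≤ v → cnt rs k x ≡ cnt rs′ k x) → rowFactor rs j row ≡ rowFactor rs′ j row
rowFactor-cong v rs rs′ j       []        _             cnt≡ = refl
rowFactor-cong v rs rs′ zero    (x ∷ row) (_ ∷ row≤v)   cnt≡ = rowFactor-cong v rs rs′ 1 row row≤v cnt≡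
rowFactor-cong v rs rs′ (suc j) (x ∷ row) (x≤v ∷ row≤v) cnt≡ =
  cong₂ _*_ (cnt≡ j x x≤v) (rowFactor-cong v rs rs′ (suc (suc j)) row row≤v cnt≡)

-- c_{ij} for an entry x in the 0-indexed column j of the topmost of the rows rs.
cellFactor : List (List ℕ) → ℕ → ℕ → ℕ
cellFactor rs zero    x = 1
cellFactor rs (suc j) x = cnt rs j x

rowFactor-∷ʳ : ∀ rs j b v → rowFactor rs j (b ∷ʳ v) ≡ rowFactor rs j b * cellFactor rs (j + length b) v
rowFactor-∷ʳ rs zero    []      v = refl
rowFactor-∷ʳ rs (suc j) []      v =
  trans (NP.*-identityʳ _) (sym (trans (NP.*-identityˡ _) (cong (λ k → cnt rs k v) (NP.+-identityʳ j))))
rowFactor-∷ʳ rs zero    (y ∷ b) v = rowFactor-∷ʳ rs 1 b v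
rowFactor-∷ʳ rs (suc j) (y ∷ b) v
  rewrite rowFactor-∷ʳ rs (suc (suc j)) b v | NP.+-suc j (length b) =
  sym (NP.*-assoc (cnt rs j y) (rowFactor rs (suc (suc j)) b) (cnt rs (suc (j + length b)) v))

at-< : ∀ r k → k < length r → ∃ λ y → at r k ≡ just y × y ∈ r
at-< (y ∷ r) zero    _        = y , refl , here refl
at-< (y ∷ r) (suc k) (s≤s k<) with z , e , z∈ ← at-< r k k< = z , e , there z∈

at-≥ : ∀ r k → length r ≤ k → at r k ≡ nothing
at-≥ []      k       _        = refl
at-≥ (y ∷ r) (suc k) (s≤s ≤k) = at-≥ r k ≤k

cnt-slots : ∀ rows k v → AllBelow v rows → All (_≤ suc k) (shape rows) →
            cnt rows k v ≡ slots (shape rows) (suc k)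
cnt-slots []         k v _              _            = refl
cnt-slots (r ∷ rows) k v (r<v ∷ rows<v) (r≤ ∷ rows≤) with length r ≟ suc k
... | yes r≡ with y , e , y∈r ← at-< r k (subst (k <_) (sym r≡) (NP.n<1+n k)) = begin
  cnt (r ∷ rows) k v                   ≡⟨ cnt-∷ r rows k v ⟩
  countBelow v (at r k) + cnt rows k v ≡⟨ cong₂ _+_ (trans (cong (countBelow v) e) (countBelow-< v y y<v))
                                                    (cnt-slots rows k v rows<v rows≤) ⟩
  suc (slots (shape rows) (suc k))     ≡⟨ slots-∷-≡ k (shape rows) r≡ ⟨
  slots (shape (r ∷ rows)) (suc k)     ∎
  where
  open ≡-Reasoning
  y<v : y < v
  y<v = All.lookup r<v y∈r
... | no r≢ = begin
  cnt (r ∷ rows) k v                   ≡⟨ cnt-∷ r rows k v ⟩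
  countBelow v (at r k) + cnt rows k v ≡⟨ cong₂ _+_ (cong (countBelow v) (at-≥ r k |r|≤k))
                                                    (cnt-slots rows k v rows<v rows≤) ⟩
  slots (shape rows) (suc k)           ≡⟨ slots-∷-≢ (suc k) (shape rows) r≢ ⟨
  slots (shape (r ∷ rows)) (suc k)     ∎
  where
  open ≡-Reasoning
  |r|≤k : length r ≤ k
  |r|≤k = NP.≤-pred (NP.≤∧≢⇒< r≤ r≢)

c-∷ʳ : ∀ v h T → 0 < length h → AllBelow v (h ∷ T) → Linked _≥_ (shape (h ∷ T)) →
       c ((h ∷ʳ v) ∷ T) ≡ c (h ∷ T) * slots (shape (h ∷ T)) (length h)
c-∷ʳ v h@(y ∷ ys) T _ h<v@(b<v ∷ _) λ≥ = begin
  rowFactor R′ 0 (h ∷ʳ v) * c T                      ≡⟨ cong (_* c T) (rowFactor-∷ʳ R′ 0 h v) ⟩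
  rowFactor R′ 0 h * cnt R′ (length ys) v * c T      ≡⟨ cong₂ (λ a b → a * b * c T) old-cells new-cell ⟩
  rowFactor R 0 h * slots (shape R) (length h) * c T ≡⟨ xy∙z≈xz∙y (rowFactor R 0 h) _ (c T) ⟩
  rowFactor R 0 h * c T * slots (shape R) (length h) ∎
  where
  open ≡-Reasoning
  R R′ : List (List ℕ)
  R  = h ∷ T
  R′ = (h ∷ʳ v) ∷ T
  cnt≡ : ∀ k x → x ≤ v → cnt R′ k x ≡ cnt R k x
  cnt≡ k x x≤v =
    subst (λ P → cnt P k x ≡ cnt R k x) (insert-∷-≡ v (length h) 0 h T refl)
          (cnt-insert v (length h) 0 R k x x≤v)
  old-cells : rowFactor R′ 0 h ≡ rowFactor R 0 h
  old-cells = rowFactor-cong v R′ R 0 h (All.map NP.<⇒≤ b<v) cnt≡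
  new-cell : cnt R′ (length ys) v ≡ slots (shape R) (length h)
  new-cell = trans (cnt≡ (length ys) v NP.≤-refl)
                   (cnt-slots R (length ys) v h<v (NP.≤-refl ∷ Linked-≥⇒All-≤ λ≥))

c-insert : ∀ v s T → NonEmptyBlocks T → AllBelow v T → Linked _≥_ (shape T) → 0 < slots (shape T) s →
           c (insert v s 0 T) ≡ c T * slots (shape T) s
c-insert v zero    [] _ _ _ _ = refl
c-insert v (suc s) [] _ _ _ ()
c-insert v s (h@(y ∷ ys) ∷ T) (_ ∷ ne) (h<v ∷ T<v) λ≥ 0< with suc (length ys) ≟ s
... | yes refl = c-∷ʳ v h T (s≤s z≤n) (h<v ∷ T<v) λ≥
... | no ≢s = begin
  rowFactor (h ∷ insert v s 0 T) 0 h * c (insert v s 0 T) ≡⟨ cong₂ _*_ old-cells ih ⟩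
  rowFactor (h ∷ T) 0 h * (c T * slots (shape T) s)       ≡⟨ NP.*-assoc (rowFactor (h ∷ T) 0 h) (c T) _ ⟨
  c (h ∷ T) * slots (shape T) s                           ≡⟨ cong (c (h ∷ T) *_) (slots-∷-≢ s (shape T) ≢s) ⟨
  c (h ∷ T) * slots (shape (h ∷ T)) s                     ∎
  where
  open ≡-Reasoning
  old-cells : rowFactor (h ∷ insert v s 0 T) 0 h ≡ rowFactor (h ∷ T) 0 h
  old-cells = rowFactor-cong v _ _ 0 h (All.map NP.<⇒≤ h<v)
                (λ k x x≤v → cong₂ _+_ refl (cnt-insert v s 0 T k x x≤v))
  ih : c (insert v s 0 T) ≡ c T * slots (shape T) s
  ih = c-insert v s T ne T<v (Linked.tail λ≥) (subst (0 <_) (slots-∷-≢ s (shape T) ≢s) 0<)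

-- One step of the recursion

range-suc : ∀ n → [ suc n ] ↭ suc n ∷ [ n ]
range-suc n = ↭-trans (↭-reflexive [suc]≡) (↭-sym (PP.∷↭∷ʳ (suc n) [ n ]))
  where
  [suc]≡ : [ suc n ] ≡ [ n ] ∷ʳ suc n
  [suc]≡ = trans (cong (map suc) (sym (LP.upTo-∷ʳ n))) (LP.map-++ suc (upTo n) (n ∷ []))

range-≤ : ∀ n → All (_≤ n) [ n ]
range-≤ n = AllP.map⁺ (All.tabulate (λ i∈ → ∈-upTo⁻ i∈))

suc∈range : ∀ n → suc n ∈ [ suc n ]
suc∈range n = ∈-map⁺ suc (∈-upTo⁺ (NP.n<1+n n))

AllAtMost-range : ∀ n P → concat P ↭ [ n ] → AllAtMost n P
AllAtMost-range n P p = AllP.concat⁻ (PP.All-resp-↭ (↭-sym p) (range-≤ n))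

AllBelow-range : ∀ n P → concat P ↭ [ n ] → AllBelow (suc n) P
AllBelow-range n P p = All.map (All.map s≤s) (AllAtMost-range n P p)

sum-shape-range : ∀ n T → concat T ↭ [ n ] → sum (shape T) ≡ n
sum-shape-range n T p = begin
  sum (shape T)             ≡⟨ length-concat T ⟨
  length (concat T)         ≡⟨ PP.↭-length p ⟩
  length (map suc (upTo n)) ≡⟨ LP.length-map suc (upTo n) ⟩
  length (upTo n)           ≡⟨ LP.length-upTo n ⟩
  n                         ∎
  where open ≡-Reasoning

concat-insert-range : ∀ n s r P → concat P ↭ [ n ] → concat (insert (suc n) s r P) ↭ [ suc n ]
concat-insert-range n s r P p =
  ↭-trans (concat-insert (suc n) s r P) (↭-trans (↭-prep (suc n) p) (↭-sym (range-suc n)))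

concat-insert-range⁻ : ∀ n s r P → concat (insert (suc n) s r P) ↭ [ suc n ] → concat P ↭ [ n ]
concat-insert-range⁻ n s r P p =
  PP.drop-∷ (↭-trans (↭-sym (concat-insert (suc n) s r P)) (↭-trans p (range-suc n)))

IsSetPartition-insert : ∀ n s r P → IsSetPartition n P → r < slots (shape P) s →
                        IsSetPartition (suc n) (insert (suc n) s r P)
IsSetPartition-insert n s r P (ne , inc , hl , p) _ =
  NonEmptyBlocks-insert (suc n) s r P ne , IncreasingBlocks-insert (suc n) s r P inc (AllBelow-range n P p) ,
  Linked-HeadLt-insert⁺ (suc n) s r P hl ne (AllBelow-range n P p) , concat-insert-range n s r P p

SetPartitionRemoval : ℕ → List (List ℕ) → Removal → Set
SetPartitionRemoval n P (P′ , s , r) =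
  IsSetPartition n P′ × r < slots (shape P′) s × insert (suc n) s r P′ ≡ P

IsSetPartition-remove : ∀ n P → IsSetPartition (suc n) P → SetPartitionRemoval n P (remove (suc n) P)
IsSetPartition-remove n P (ne , inc , hl , p) with P≤v ← AllAtMost-range (suc n) P p
  with remove (suc n) P
     | insert-remove (suc n) P ne inc P≤v (PP.∈-resp-↭ (↭-sym p) (suc∈range n))
                     (SingletonLast-HeadLt (suc n) P hl P≤v)
... | (P′ , s , r) | (refl , ne′ , inc′ , r<) =
  (ne′ , inc′ , Linked-HeadLt-insert⁻ (suc n) s r P′ ne′ hl , concat-insert-range⁻ n s r P′ p) , r< , refl

IsStdTab-insert : ∀ n s T → IsStdTab n T → 0 < slots (shape T) s →
                  IsStdTab (suc n) (insert (suc n) s 0 T) × c (insert (suc n) s 0 T) ≡ c T * slots (shape T) s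
IsStdTab-insert n s T ((λ≥ , pos , _) , inc , ↑ , p) 0<
  with ne ← AllP.map⁻ pos | T<v ← AllBelow-range n T p
  with λ≥′ , ↑′ ← Tableau-insert⁺ (suc n) s T ne T<v λ≥ ↑ =
  ((λ≥′ , AllP.map⁺ (NonEmptyBlocks-insert (suc n) s 0 T ne) , sum-shape-range (suc n) T′ p′) ,
   IncreasingBlocks-insert (suc n) s 0 T inc T<v , ↑′ , p′) ,
  c-insert (suc n) s T ne T<v λ≥ 0<
  where
  T′ : List (List ℕ)
  T′ = insert (suc n) s 0 T
  p′ : concat T′ ↭ [ suc n ]
  p′ = concat-insert-range n s 0 T p

TableauRemoval : ℕ → List (List ℕ) → Removal → Set
TableauRemoval n T (T′ , s , r) =
  IsStdTab n T′ × r ≡ 0 × 0 < slots (shape T′) s × insert (suc n) s 0 T′ ≡ T ×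
  c T ≡ c T′ * slots (shape T′) s

IsStdTab-remove : ∀ n T → IsStdTab (suc n) T → TableauRemoval n T (remove (suc n) T)
IsStdTab-remove n T ((λ≥ , pos , _) , inc , ↑ , p)
  with ne ← AllP.map⁻ pos | T≤v ← AllAtMost-range (suc n) T p
  with remove (suc n) T
     | insert-remove (suc n) T ne inc T≤v (PP.∈-resp-↭ (↭-sym p) (suc∈range n))
                     (SingletonLast-ColsInc (suc n) T ↑ T≤v ne)
... | (T′ , s , r) | (refl , ne′ , inc′ , r<)
  with refl ← insert-sorted⇒r≡0 (suc n) s r T′ ne′ r< λ≥
  with p′ ← concat-insert-range⁻ n s 0 T′ p
  with λ≥′ , ↑′ ← Tableau-insert⁻ (suc n) s T′ ne′ (AllBelow-range n T′ p′) λ≥ ↑ =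
  ((λ≥′ , AllP.map⁺ ne′ , sum-shape-range n T′ p′) , inc′ , ↑′ , p′) ,
  refl , r< , refl , c-insert (suc n) s T′ ne′ (AllBelow-range n T′ p′) λ≥′ r<

-- The bijection

-- Division with remainder, returning (0 , i) for the divisor 0, which never occurs below.
quotient remainder : ℕ → ℕ → ℕ
quotient  i zero    = 0
quotient  i (suc d) = i / suc d
remainder i zero    = i
remainder i (suc d) = i % suc d

remainder+quotient* : ∀ i d → 0 < d → i ≡ remainder i d + quotient i d * d
remainder+quotient* i (suc d) _ = DM.m≡m%n+[m/n]*n i (suc d)

remainder< : ∀ i d → 0 < d → remainder i d < d
remainder< i (suc d) _ = DM.m%n<n i (suc d)

quotient< : ∀ i d f → 0 < d → i < d * f → quotient i d < f
quotient< i (suc d) f _ i< = DM.m<n*o⇒m/o<n (subst (i <_) (NP.*-comm (suc d) f) i<)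

remainder-+* : ∀ j q d → j < d → remainder (j + q * d) d ≡ j
remainder-+* j q (suc d) j<d = trans (DM.[m+kn]%n≡m%n j q (suc d)) (DM.m<n⇒m%n≡m j<d)

quotient-+* : ∀ j q d → j < d → quotient (j + q * d) d ≡ q
quotient-+* j q (suc d) j<d = begin
  (j + q * suc d) / suc d       ≡⟨ DM.+-distrib-/ j (q * suc d) j%+qd%<d ⟩
  j / suc d + q * suc d / suc d ≡⟨ cong₂ _+_ (DM.m<n⇒m/n≡0 j<d) (DM.m*n/n≡m q (suc d)) ⟩
  q                             ∎
  where
  open ≡-Reasoning
  j%+qd%<d : j % suc d + q * suc d % suc d < suc d
  j%+qd%<d = subst (_< suc d) (sym (cong₂ _+_ (DM.m<n⇒m%n≡m j<d) (DM.m*n%n≡0 q (suc d))))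
                   (subst (_< suc d) (sym (NP.+-identityʳ j)) j<d)

mixed-radix-< : ∀ j q d f → j < d → q < f → j + q * d < d * f
mixed-radix-< j q d f j<d q<f = NP.<-≤-trans (NP.+-monoˡ-< (q * d) j<d)
  (subst (_≤ d * f) (NP.*-comm d (suc q)) (NP.*-monoʳ-≤ d q<f))

IsSetPartition-0 : ∀ P → IsSetPartition 0 P → P ≡ []
IsSetPartition-0 []            _               = refl
IsSetPartition-0 ([] ∷ P)      ((() ∷ _) , _)
IsSetPartition-0 ((x ∷ b) ∷ P) (_ , _ , _ , p) with () ← PP.↭-empty-inv p

IsStdTab-0 : ∀ T → IsStdTab 0 T → T ≡ []
IsStdTab-0 []            _                      = refl
IsStdTab-0 ([] ∷ T)      ((_ , () ∷ _ , _) , _)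
IsStdTab-0 ((x ∷ b) ∷ T) (_ , _ , _ , p)        with () ← PP.↭-empty-inv p

IsSetPartition-[] : IsSetPartition 0 []
IsSetPartition-[] = [] , [] , [] , ↭-refl

IsStdTab-[] : IsStdTab 0 []
IsStdTab-[] = ([] , [] , refl) , [] , [] , ↭-refl

-- i records in mixed radix the choices r made when inserting 1, …, n, the one for n being most significant.
toTableau : ℕ → List (List ℕ) → List (List ℕ) × ℕ
toTableauStep : ℕ → Removal → List (List ℕ) × ℕ
toTableau zero    P = [] , 0
toTableau (suc n) P = toTableauStep n (remove (suc n) P)
toTableauStep n (P′ , s , r) =
  insert (suc n) s 0 (proj₁ (toTableau n P′)) , proj₂ (toTableau n P′) + r * c (proj₁ (toTableau n P′))

toPartition : ℕ → List (List ℕ) → ℕ → List (List ℕ)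
toPartitionStep : ℕ → Removal → ℕ → List (List ℕ)
toPartition zero    T i = []
toPartition (suc n) T i = toPartitionStep n (remove (suc n) T) i
toPartitionStep n (T′ , s , _) i =
  insert (suc n) s (quotient i (c T′)) (toPartition n T′ (remainder i (c T′)))

IsCode : ℕ → List (List ℕ) → List (List ℕ) × ℕ → Set
IsCode n P (T , i) = IsStdTab n T × i < c T × shape P ↭ shape T

toTableau-IsCode : ∀ n P → IsSetPartition n P → IsCode n P (toTableau n P)
toTableauStep-IsCode : ∀ n P t → SetPartitionRemoval n P t → IsCode (suc n) P (toTableauStep n t)
toTableau-IsCode zero    P sp rewrite IsSetPartition-0 P sp = IsStdTab-[] , s≤s z≤n , ↭-refl
toTableau-IsCode (suc n) P sp = toTableauStep-IsCode n P (remove (suc n) P) (IsSetPartition-remove n P sp)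
toTableauStep-IsCode n P (P′ , s , r) (sp′ , r< , refl) with toTableau n P′ | toTableau-IsCode n P′ sp′
... | (T′ , i′) | (tab′ , i′< , P′∼T′) = proj₁ step , i< , shape↭
  where
  slots≡ : slots (shape P′) s ≡ slots (shape T′) s
  slots≡ = slots-↭ s P′∼T′
  0<slots : 0 < slots (shape T′) s
  0<slots = subst (0 <_) slots≡ (NP.m<n⇒0<n r<)
  step : IsStdTab (suc n) (insert (suc n) s 0 T′) × c (insert (suc n) s 0 T′) ≡ c T′ * slots (shape T′) s
  step = IsStdTab-insert n s T′ tab′ 0<slots
  i< : i′ + r * c T′ < c (insert (suc n) s 0 T′)
  i< = subst (i′ + r * c T′ <_) (sym (proj₂ step))
             (mixed-radix-< i′ r (c T′) _ i′< (subst (r <_) slots≡ r<))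
  shape↭ : shape (insert (suc n) s r P′) ↭ shape (insert (suc n) s 0 T′)
  shape↭ = ShapeGrows-↭ s (shape P′) (shape T′) _ _ (AllP.map⁺ (proj₁ sp′)) P′∼T′
             (shape-insert (suc n) s r P′ (proj₁ sp′) r<)
             (shape-insert (suc n) s 0 T′ (AllP.map⁻ (proj₁ (proj₂ (proj₁ tab′)))) 0<slots)

DecodesTo : ℕ → List (List ℕ) → ℕ → List (List ℕ) → Set
DecodesTo n T i P = IsSetPartition n P × toTableau n P ≡ (T , i)

toPartition-DecodesTo : ∀ n T i → IsStdTab n T → i < c T → DecodesTo n T i (toPartition n T i)
toPartitionStep-DecodesTo : ∀ n T i t → TableauRemoval n T t → i < c T →
                            DecodesTo (suc n) T i (toPartitionStep n t i)
toPartition-DecodesTo zero T i tab i< with refl ← IsStdTab-0 T tab with refl ← NP.n<1⇒n≡0 i< =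
  IsSetPartition-[] , refl
toPartition-DecodesTo (suc n) T i tab i< =
  toPartitionStep-DecodesTo n T i (remove (suc n) T) (IsStdTab-remove n T tab) i<
toPartitionStep-DecodesTo n T i (T′ , s , .0) (tab′ , refl , _ , refl , c≡) i< = sp , toTableauStep≡
  where
  d : ℕ
  d = c T′
  i<d*slots : i < d * slots (shape T′) s
  i<d*slots = subst (i <_) c≡ i<
  0<d : 0 < d
  0<d = >-nonZero⁻¹ d {{NP.m*n≢0⇒m≢0 d {{>-nonZero (NP.m<n⇒0<n i<d*slots)}}}}
  P′ : List (List ℕ)
  P′ = toPartition n T′ (remainder i d)
  ih : DecodesTo n T′ (remainder i d) P′
  ih = toPartition-DecodesTo n T′ (remainder i d) tab′ (remainder< i d 0<d)
  sp′ : IsSetPartition n P′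
  sp′ = proj₁ ih
  toTableau≡ : toTableau n P′ ≡ (T′ , remainder i d)
  toTableau≡ = proj₂ ih
  P′∼T′ : shape P′ ↭ shape T′
  P′∼T′ = subst (λ x → shape P′ ↭ shape (proj₁ x)) toTableau≡
                (proj₂ (proj₂ (toTableau-IsCode n P′ sp′)))
  q< : quotient i d < slots (shape P′) s
  q< = subst (quotient i d <_) (sym (slots-↭ s P′∼T′)) (quotient< i d _ 0<d i<d*slots)
  sp : IsSetPartition (suc n) (insert (suc n) s (quotient i d) P′)
  sp = IsSetPartition-insert n s (quotient i d) P′ sp′ q<
  toTableauStep≡ : toTableauStep n (remove (suc n) (insert (suc n) s (quotient i d) P′)) ≡
                   (insert (suc n) s 0 T′ , i)
  toTableauStep≡
    rewrite remove-insert (suc n) s (quotient i d) P′ (proj₁ sp′)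
              (AllBelow-range n P′ (proj₂ (proj₂ (proj₂ sp′)))) q<
          | toTableau≡ = cong (insert (suc n) s 0 T′ ,_) (sym (remainder+quotient* i d 0<d))

toPartition-toTableau : ∀ n P → IsSetPartition n P → uncurry (toPartition n) (toTableau n P) ≡ P
toPartitionStep-toTableauStep : ∀ n P t → SetPartitionRemoval n P t →
                                uncurry (toPartition (suc n)) (toTableauStep n t) ≡ P
toPartition-toTableau zero    P sp = sym (IsSetPartition-0 P sp)
toPartition-toTableau (suc n) P sp =
  toPartitionStep-toTableauStep n P (remove (suc n) P) (IsSetPartition-remove n P sp)
toPartitionStep-toTableauStep n P (P′ , s , r) (sp′ , r< , refl)
  with toTableau n P′ | toTableau-IsCode n P′ sp′ | toPartition-toTableau n P′ sp′
... | (T′ , i′) | ((_ , pos , _) , _ , _ , T′↭) , i′< , P′∼T′ | ih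
  rewrite remove-insert (suc n) s 0 T′ (AllP.map⁻ pos) (AllBelow-range n T′ T′↭)
            (subst (0 <_) (slots-↭ s P′∼T′) (NP.m<n⇒0<n r<))
        | quotient-+* i′ r (c T′) i′< | remainder-+* i′ r (c T′) i′< | ih = refl

-- Counting

lookup-injective : ∀ {D : Set} (L : List D) → Unique L → ∀ i j → lookup L i ≡ lookup L j → i ≡ j
lookup-injective (x ∷ L) (x∉ ∷ u) Fin.zero    Fin.zero    _ = refl
lookup-injective (x ∷ L) (x∉ ∷ u) Fin.zero    (Fin.suc j) e = ⊥-elim (All.lookup x∉ (∈-lookup j) e)
lookup-injective (x ∷ L) (x∉ ∷ u) (Fin.suc i) Fin.zero    e = ⊥-elim (All.lookup x∉ (∈-lookup i) (sym e))
lookup-injective (x ∷ L) (x∉ ∷ u) (Fin.suc i) (Fin.suc j) e = cong Fin.suc (lookup-injective L u i j e)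

HasCount-enumeration : ∀ {D : Set} {P : D → Set} (L : List D) → Unique L →
                       (∀ d → d ∈ L → P d) → (∀ d → P d → d ∈ L) → P HasCount length L
HasCount-enumeration L u sound complete =
  lookup L , (λ i → sound _ (∈-lookup i)) , lookup-injective L u ,
  λ d Pd → let d∈ = complete d Pd in Any.index d∈ , sym (lookup-index d∈)

HasCount-filter : ∀ {D : Set} {A Q R : D → Set} (R? : Decidable R) (L : List D) → Unique L →
                  (∀ d → d ∈ L → A d) → (∀ d → A d → d ∈ L) → (∀ d → A d → Q d ⇔ R d) →
                  (λ d → A d × Q d) HasCount length (filter R? L)
HasCount-filter R? L u sound complete Q⇔R = HasCount-enumeration (filter R? L) (UniqueP.filter⁺ R? u)
  (λ d d∈ → let (d∈L , Rd) = ∈-filter⁻ R? d∈ in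
             sound d d∈L , Equivalence.from (Q⇔R d (sound d d∈L)) Rd)
  (λ d (Ad , Qd) → ∈-filter⁺ R? (complete d Ad) (Equivalence.to (Q⇔R d Ad) Qd))

SameCount : ∀ {D E : Set} → (D → Set) → (E → Set) → Set
SameCount P Q = ∃ λ k → P HasCount k × Q HasCount k

SameCount-bijection : ∀ {D E : Set} {P : D → Set} {Q : E → Set} (f : D → E) (g : E → D) →
                      (∀ a → P a → Q (f a)) → (∀ b → Q b → P (g b)) →
                      (∀ a → P a → g (f a) ≡ a) → (∀ b → Q b → f (g b) ≡ b) →
                      ∃ (P HasCount_) → SameCount P Q
SameCount-bijection f g P⇒Q Q⇒P gf fg (k , e , Pe , e-inj , e-onto) =
  k , (e , Pe , e-inj , e-onto) ,
  f ∘ e , (λ i → P⇒Q _ (Pe i)) ,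
  (λ i j fei≡fej → e-inj i j (trans (sym (gf _ (Pe i))) (trans (cong g fei≡fej) (gf _ (Pe j))))) ,
  λ b Qb → let (i , ei≡) = e-onto (g b) (Q⇒P b Qb) in i , trans (cong f ei≡) (fg b Qb)

extensionsBy : ℕ → List (List ℕ) → ℕ → List (List (List ℕ))
extensionsBy n P′ s = map (λ r → insert (suc n) s r P′) (upTo (slots (shape P′) s))

extensions : ℕ → List (List ℕ) → List (List (List ℕ))
extensions n P′ = concatMap (extensionsBy n P′) (0 ∷ shape P′)

candidates : ℕ → List (List (List ℕ))
candidates zero    = [] ∷ []
candidates (suc n) = concatMap (extensions n) (candidates n)

candidates-sound : ∀ n P → P ∈ candidates n → IsSetPartition n P
candidates-sound zero    P (here refl) = IsSetPartition-[]
candidates-sound (suc n) P P∈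
  with P′ , P′∈ , P∈ext ← find (∈-concatMap⁻ (extensions n) P∈)
  with s , _ , P∈s ← find (∈-concatMap⁻ (extensionsBy n P′) {xs = 0 ∷ shape P′} P∈ext)
  with r , r∈ , refl ← ∈-map⁻ (λ r → insert (suc n) s r P′) P∈s =
  IsSetPartition-insert n s r P′ (candidates-sound n P′ P′∈) (∈-upTo⁻ r∈)

candidates-complete : ∀ n P → IsSetPartition n P → P ∈ candidates n
candidates-complete zero    P sp rewrite IsSetPartition-0 P sp = here refl
candidates-complete (suc n) P sp with remove (suc n) P | IsSetPartition-remove n P sp
... | (P′ , s , r) | (sp′ , r< , refl) =
  ∈-concatMap⁺ (extensions n) (lose (candidates-complete n P′ sp′)
    (∈-concatMap⁺ (extensionsBy n P′) {xs = 0 ∷ shape P′}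
      (lose s∈ (∈-map⁺ (λ r → insert (suc n) s r P′) (∈-upTo⁺ r<)))))
  where
  s∈ : s ∈ 0 ∷ shape P′
  s∈ with shape-insert (suc n) s r P′ (proj₁ sp′) r<
  ... | inj₁ (refl , _)            = here refl
  ... | inj₂ (a₁ , _ , shape≡ , _) = there (subst (s ∈_) (sym shape≡) (∈-++⁺ʳ a₁ (here refl)))

_≟ᴾ_ : DecidableEquality (List (List ℕ))
_≟ᴾ_ = LP.≡-dec (LP.≡-dec _≟_)

setPartitions : ℕ → List (List (List ℕ))
setPartitions n = deduplicate _≟ᴾ_ (candidates n)

setPartitions-sound : ∀ n P → P ∈ setPartitions n → IsSetPartition n P
setPartitions-sound n P P∈ = candidates-sound n P (∈-deduplicate⁻ _≟ᴾ_ (candidates n) P∈)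

setPartitions-complete : ∀ n P → IsSetPartition n P → P ∈ setPartitions n
setPartitions-complete n P sp = ∈-deduplicate⁺ _≟ᴾ_ (candidates-complete n P sp)

HasCount-setPartitions : ∀ n → IsSetPartition n HasCount length (setPartitions n)
HasCount-setPartitions n = HasCount-enumeration (setPartitions n) (deduplicate-! _≟ᴾ_ (candidates n))
  (setPartitions-sound n) (setPartitions-complete n)

HasCount-setPartitions-filter : ∀ n {Q R : List (List ℕ) → Set} → Decidable R →
                                (∀ P → IsSetPartition n P → Q P ⇔ R P) →
                                ∃ ((λ P → IsSetPartition n P × Q P) HasCount_)
HasCount-setPartitions-filter n R? Q⇔R = _ , HasCount-filter R? (setPartitions n)
  (deduplicate-! _≟ᴾ_ (candidates n)) (setPartitions-sound n) (setPartitions-complete n) Q⇔R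

toTableau-sound : ∀ n P → IsSetPartition n P → let (T , i) = toTableau n P in IsStdTab n T × i < c T
toTableau-sound n P sp with tab , i< , _ ← toTableau-IsCode n P sp = tab , i<

shape-toTableau : ∀ n P → IsSetPartition n P → shape P ↭ shape (proj₁ (toTableau n P))
shape-toTableau n P sp = proj₂ (proj₂ (toTableau-IsCode n P sp))

toPartition-sound : ∀ n T i → IsStdTab n T → i < c T → IsSetPartition n (toPartition n T i)
toPartition-sound n T i tab i< = proj₁ (toPartition-DecodesTo n T i tab i<)

toTableau-toPartition : ∀ n T i → IsStdTab n T → i < c T → toTableau n (toPartition n T i) ≡ (T , i)
toTableau-toPartition n T i tab i< = proj₂ (toPartition-DecodesTo n T i tab i<)

shape-toPartition : ∀ n T i → IsStdTab n T → i < c T → shape (toPartition n T i) ↭ shape T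
shape-toPartition n T i tab i< =
  subst (λ x → shape (toPartition n T i) ↭ shape (proj₁ x)) (toTableau-toPartition n T i tab i<)
        (shape-toTableau n _ (toPartition-sound n T i tab i<))

SameCount-shape : ∀ n lam → IsPartition n lam →
                  SameCount (λ blocks → IsSetPartition n blocks × HasShape blocks lam)
                            (λ (Ti : List (List ℕ) × ℕ) → let (T , i) = Ti in
                               IsStdTabOfShape n lam T × i < c T)
SameCount-shape n lam (lam≥ , _) =
  SameCount-bijection (toTableau n) (uncurry (toPartition n))
    (λ P (sp , P∼lam) → let (tab , i<) = toTableau-sound n P sp in
       (Equivalence.to (hasShape⇔ P sp) P∼lam , tab) , i<)
    (λ { (T , i) ((refl , tab) , i<) → toPartition-sound n T i tab i< , shape-toPartition n T i tab i< })
    (λ P (sp , _) → toPartition-toTableau n P sp)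
    (λ { (T , i) ((_ , tab) , i<) → toTableau-toPartition n T i tab i< })
    (HasCount-setPartitions-filter n (λ P → LP.≡-dec _≟_ (shape (proj₁ (toTableau n P))) lam) hasShape⇔)
  where
  -- The shape of a tableau is sorted, so it is determined by its multiset of row lengths.
  hasShape⇔ : ∀ P → IsSetPartition n P → HasShape P lam ⇔ shape (proj₁ (toTableau n P)) ≡ lam
  hasShape⇔ P sp = mk⇔
    (λ P∼lam → sorted-↭⇒≡ (proj₁ (proj₁ (proj₁ (toTableau-sound n P sp)))) lam≥
                          (↭-trans (↭-sym (shape-toTableau n P sp)) P∼lam))
    (λ T≡lam → subst (shape P ↭_) T≡lam (shape-toTableau n P sp))

SameCount-length : ∀ n m →
                   SameCount (λ blocks → IsSetPartition n blocks × length blocks ≡ m)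
                             (λ (x : List ℕ × List (List ℕ) × ℕ) → let (lam , T , i) = x in
                                IsPartition n lam × length lam ≡ m × IsStdTabOfShape n lam T × i < c T)
SameCount-length n m =
  SameCount-bijection (λ P → shape (proj₁ (toTableau n P)) , toTableau n P) (λ (_ , T , i) → toPartition n T i)
    (λ P (sp , P≡m) → let (tab , i<) = toTableau-sound n P sp in
       proj₁ tab , trans (sym (PP.↭-length (shape-toTableau n P sp))) (trans (length-shape P) P≡m) ,
       (refl , tab) , i<)
    (λ { (lam , T , i) (_ , lam≡m , (refl , tab) , i<) →
           toPartition-sound n T i tab i< ,
           trans (sym (length-shape (toPartition n T i)))
                 (trans (PP.↭-length (shape-toPartition n T i tab i<)) lam≡m) })
    (λ P (sp , _) → toPartition-toTableau n P sp)
    (λ { (lam , T , i) (_ , _ , (refl , tab) , i<) →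
           cong (λ Ti → shape (proj₁ Ti) , Ti) (toTableau-toPartition n T i tab i<) })
    (HasCount-setPartitions-filter n (λ P → length P ≟ m) (λ _ _ → mk⇔ id id))
  where
  length-shape : ∀ P → length (shape P) ≡ length P
  length-shape = LP.length-map length

SameCount-all : ∀ n → SameCount (IsSetPartition n)
                                (λ (Ti : List (List ℕ) × ℕ) → let (T , i) = Ti in IsStdTab n T × i < c T)
SameCount-all n =
  SameCount-bijection (toTableau n) (uncurry (toPartition n))
    (toTableau-sound n) (λ (T , i) (tab , i<) → toPartition-sound n T i tab i<)
    (toPartition-toTableau n) (λ (T , i) (tab , i<) → toTableau-toPartition n T i tab i<)
    (_ , HasCount-setPartitions n)

corollary2p11 : (∀ (n : ℕ) (lam : List ℕ) → IsPartition n lam →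
                   ∃ λ k →
                     ((λ blocks → IsSetPartition n blocks × HasShape blocks lam) HasCount k)
                     × ((λ (Ti : List (List ℕ) × ℕ) → let (T , i) = Ti in
                            IsStdTabOfShape n lam T × i < c T) HasCount k))
                × (∀ (n m : ℕ) →
                     ∃ λ k →
                       ((λ blocks → IsSetPartition n blocks × length blocks ≡ m) HasCount k)
                       × ((λ (x : List ℕ × List (List ℕ) × ℕ) → let (lam , T , i) = x in
                              IsPartition n lam × length lam ≡ m × IsStdTabOfShape n lam T × i < c T) HasCount k))
                × (∀ (n : ℕ) → 1 ≤ n →
                     ∃ λ k →
                       (IsSetPartition n HasCount k)
                       × ((λ (Ti : List (List ℕ) × ℕ) → let (T , i) = Ti in
                              IsStdTab n T × i < c T) HasCount k))
corollary2p11 = SameCount-shape , SameCount-length , λ n _ → SameCount-all n
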